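{- Let $F$ be a field and let $A_1,\dots,A_n$ be finite multiplicative subgroups of $F^*$. Assume that $f\in F[X_1,\dots,X_n]$ satisfies \[\deg(f)\leq(|A_1|-1)+\dots+(|A_n|-1)+\min\{|A_1|,\dots,|A_n|\}-1.\] Then the coefficient of $X_1^{|A_1|-1}\cdots X_n^{|A_n|-1}$ in $f$ equals \[\frac{1}{|A_1\times\dots\times A_n|}\sum_{(a_1,\dots,a_n)\in A_1\times\dots\times A_n}a_1\cdots a_n\,f(a_1,\dots,a_n).\]
   Context: $\deg(f)$ is the total degree; $|A_1\times\dots\times A_n|$ is interpreted as an element of $F$ (it is non-zero in $F$). -}

module Defs where

open import Level using (Level; _⊔_) renaming (suc to lsuc)
open import Algebra.Bundles using (CommutativeRing)
open import Data.Nat as ℕ using (ℕ; zero; suc; _∸_; _<_)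
open import Data.Nat.Properties using () renaming (_≟_ to _≟ℕ_)
open import Data.Fin using (Fin)
open import Data.Product using (Σ; _×_; _,_; proj₁; proj₂)
open import Data.List using (List; []; _∷_; map; concatMap; foldr)
open import Data.Vec using (Vec; tabulate; lookup)
open import Data.Vec.Properties using (≡-dec)
open import Data.Vec.Functional as VF using (Vector)
open import Relation.Nullary using (¬_; yes; no)
open import Relation.Binary.PropositionalEquality using (_≡_)

record Field (c ℓ : Level) : Set (lsuc (c ⊔ ℓ)) where
  field
    commutativeRing : CommutativeRing c ℓ
  open CommutativeRing commutativeRing public
  field
    0≉1     : ¬ (0# ≈ 1#)
    inverse : (x : Carrier) → ¬ (x ≈ 0#) → Σ Carrier (λ y → x * y ≈ 1#)

  _⁻¹[_] : (x : Carrier) → ¬ (x ≈ 0#) → Carrier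
  x ⁻¹[ nz ] = proj₁ (inverse x nz)

sumℕ : (n : ℕ) → (Fin n → ℕ) → ℕ
sumℕ n f = foldr ℕ._+_ 0 (Data.List.map f (Data.List.allFin n))
  where import Data.List

minℕ : (n : ℕ) → (Fin n → ℕ) → ℕ   -- junk value 0 when n = 0
minℕ zero    f = 0
minℕ (suc zero) f = f Fin.zero
  where import Data.Fin as Fin
minℕ (suc (suc n)) f = f Fin.zero ℕ.⊓ minℕ (suc n) (λ i → f (Fin.suc i))
  where import Data.Fin as Fin

-- Polynomials in n variables over a field, as finite lists of terms
-- (coefficient , exponent vector).  Like terms are combined when reading
-- off coefficients, so this is a presentation of F[X₁,…,Xₙ].
module FieldDefs {c ℓ : Level} (F : Field c ℓ) where
  open Field F

  Poly : ℕ → Set c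
  Poly n = List (Carrier × Vec ℕ n)

  Σ' : List Carrier → Carrier
  Σ' = foldr _+_ 0#

  pow : Carrier → ℕ → Carrier
  pow x zero    = 1#
  pow x (suc k) = x * pow x k

  prodF : (n : ℕ) → (Fin n → Carrier) → Carrier
  prodF n g = foldr _*_ 1# (map g (Data.List.allFin n))
    where import Data.List

  coeff : ∀ {n} → Poly n → Vec ℕ n → Carrier
  coeff [] e = 0#
  coeff ((a , e') ∷ f) e with ≡-dec _≟ℕ_ e' e
  ... | yes _ = a + coeff f e
  ... | no  _ = coeff f e

  DegLe : ∀ {n} → Poly n → ℕ → Set ℓ
  DegLe {n} f d = (e : Vec ℕ n) → d < sumℕ n (lookup e) → coeff f e ≈ 0#

  eval : ∀ {n} → Poly n → Vector Carrier n → Carrier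
  eval {n} f a = Σ' (map (λ t → proj₁ t * prodF n (λ i → pow (a i) (lookup (proj₂ t) i))) f)

  natF : ℕ → Carrier
  natF zero    = 0#
  natF (suc k) = 1# + natF k

  record FiniteSubgroup : Set (c ⊔ ℓ) where
    field
      size      : ℕ
      elem      : Fin size → Carrier
      distinct  : ∀ i j → elem i ≈ elem j → i ≡ j
      nonzero   : ∀ i → ¬ (elem i ≈ 0#)
      has-one   : Σ (Fin size) (λ i → elem i ≈ 1#)
      mul-closed : ∀ i j → Σ (Fin size) (λ k → elem i * elem j ≈ elem k)
      inv-closed : ∀ i → Σ (Fin size) (λ j → elem i * elem j ≈ 1#)

  open FiniteSubgroup public

  grid : (n : ℕ) → (Fin n → List Carrier) → List (Vector Carrier n)
  grid zero    A = VF.[] ∷ []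
  grid (suc n) A = concatMap (λ a → map (a VF.∷_) (grid n (λ i → A (Fin.suc i)))) (A Fin.zero)
    where import Data.Fin as Fin

  elems : FiniteSubgroup → List Carrier
  elems G = map (elem G) (Data.List.allFin (size G))
    where import Data.List

prodℕ : (n : ℕ) → (Fin n → ℕ) → ℕ
prodℕ n f = foldr ℕ._*_ 1 (Data.List.map f (Data.List.allFin n))
  where import Data.List

-- Let A ≤ F* have order m and s = Σ_{x∈A} x^k.  Translating by a ∈ A shows a^k·s = s; since also
-- a^m = 1, for r = k mod m the polynomial s·X^r − s vanishes on the m points of A, and as its degree
-- is < m, s = 0 unless m ∣ k.  If m ∣ k then s = m, which is non-zero in F since otherwise
-- 1 + X + ⋯ + X^(m−1) would vanish on all of A.
-- Summing a₁⋯aₙ·f(a) over A₁ × ⋯ × Aₙ pairs each monomial X^e of f with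
-- ∏ᵢ Σ_{x∈Aᵢ} x^(eᵢ+1), which is 0 unless every mᵢ divides eᵢ+1.  Under the degree bound
-- the only such exponent is (m₁−1, …, mₙ−1), whose pairing is m₁⋯mₙ.

module Submission where

open import Defs
open import Level using (Level)
open import Algebra.Bundles using (CommutativeMonoid)
import Algebra.Properties.CommutativeMonoid.Sum
import Algebra.Properties.Semiring.Sum
open import Data.Nat as ℕ using (ℕ; zero; suc; _∸_; _≤_; _<_; z≤n; s≤s) renaming (_+_ to _+ℕ_)
open import Data.Nat.Divisibility using (_∣_; divides; _∣?_; ∣⇒≤; m%n≡0⇒n∣m)
open import Data.Nat.DivMod using (_%_; _/_; m≡m%n+[m/n]*n; m%n<n)
open import Data.Nat.ListAction using (sum)
import Data.Nat.Properties as ℕₚ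
open import Algebra.Properties.CommutativeSemigroup ℕₚ.+-commutativeSemigroup using (xy∙z≈xz∙y)
open import Data.Fin as Fin using (Fin)
open import Data.Fin.Permutation using (Permutation; permutation)
import Data.Fin.Properties as Finₚ
open import Data.Vec using (Vec; tabulate; lookup)
open import Data.Vec.Properties using (≡-dec)
import Data.Vec.Properties as Vecₚ
open import Data.Vec.Functional as VF using (Vector)
open import Data.List as List using (List; []; _∷_; map; foldr)
import Data.List.Properties as Listₚ
open import Data.List.Membership.Propositional using (_∈_)
open import Data.List.Membership.Propositional.Properties using (∈-allFin)
open import Data.List.Relation.Unary.All using (All; []; _∷_)
open import Data.List.Relation.Unary.Any using (here; there)
open import Data.Product using (Σ; ∃; _,_; proj₁; proj₂)
open import Data.Sum as Sum using (_⊎_; inj₁; inj₂; [_,_]′)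
open import Function using (_∘_; id)
open import Relation.Nullary using (¬_; ¬?; Dec; yes; no; contradiction)
open import Relation.Binary.PropositionalEquality as ≡ using (_≡_; _≢_)

sum-map-mono-≤ : ∀ {a} {X : Set a} {f g : X → ℕ} → (∀ x → f x ≤ g x) →
                 ∀ xs → sum (map f xs) ≤ sum (map g xs)
sum-map-mono-≤ f≤g []       = z≤n
sum-map-mono-≤ f≤g (x ∷ xs) = ℕₚ.+-mono-≤ (f≤g x) (sum-map-mono-≤ f≤g xs)

sum-map-+-≤ : ∀ {a} {X : Set a} {f g : X → ℕ} → (∀ x → f x ≤ g x) →
              ∀ {x xs} k → x ∈ xs → f x +ℕ k ≤ g x → sum (map f xs) +ℕ k ≤ sum (map g xs)
sum-map-+-≤ {f = f} {g} f≤g {x} {_ ∷ xs} k (here ≡.refl) fx+k≤gx = begin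
  f x +ℕ sum (map f xs) +ℕ k   ≡⟨ xy∙z≈xz∙y (f x) _ k ⟩
  f x +ℕ k +ℕ sum (map f xs)   ≤⟨ ℕₚ.+-mono-≤ fx+k≤gx (sum-map-mono-≤ f≤g xs) ⟩
  g x +ℕ sum (map g xs)        ∎
  where open ℕₚ.≤-Reasoning
sum-map-+-≤ {f = f} {g} f≤g {xs = y ∷ xs} k (there x∈xs) fx+k≤gx = begin
  f y +ℕ sum (map f xs) +ℕ k   ≡⟨ ℕₚ.+-assoc (f y) _ k ⟩
  f y +ℕ (sum (map f xs) +ℕ k) ≤⟨ ℕₚ.+-mono-≤ (f≤g y) (sum-map-+-≤ f≤g k x∈xs fx+k≤gx) ⟩
  g y +ℕ sum (map g xs)        ∎
  where open ℕₚ.≤-Reasoning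

minℕ-≤ : ∀ n (f : Fin n → ℕ) i → minℕ n f ≤ f i
minℕ-≤ (suc zero)    f Fin.zero    = ℕₚ.≤-refl
minℕ-≤ (suc (suc n)) f Fin.zero    = ℕₚ.m⊓n≤m _ _
minℕ-≤ (suc (suc n)) f (Fin.suc i) = ℕₚ.≤-trans (ℕₚ.m⊓n≤n _ _) (minℕ-≤ (suc n) (f ∘ Fin.suc) i)

∣suc⇒≡pred⊎≥ : ∀ {m x} → m ∣ suc x → x ≡ m ∸ 1 ⊎ m ∸ 1 +ℕ m ≤ x
∣suc⇒≡pred⊎≥ {zero}  (divides q eq) = contradiction (≡.trans eq (ℕₚ.*-zeroʳ q)) λ ()
∣suc⇒≡pred⊎≥ {suc m} (divides zero ())
∣suc⇒≡pred⊎≥ {suc m} (divides (suc zero) eq) = inj₁ (ℕₚ.suc-injective (≡.trans eq (ℕₚ.+-identityʳ (suc m))))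
∣suc⇒≡pred⊎≥ {suc m} {x} (divides (suc (suc q)) eq) = inj₂ (ℕₚ.≤-pred (begin
  suc (m +ℕ suc m)                   ≤⟨ s≤s (ℕₚ.m≤m+n (m +ℕ suc m) (q ℕ.* suc m)) ⟩
  suc (m +ℕ suc m +ℕ q ℕ.* suc m)    ≡⟨ ≡.cong suc (ℕₚ.+-assoc m (suc m) _) ⟩
  suc (m +ℕ (suc m +ℕ q ℕ.* suc m))  ≡⟨ eq ⟨
  suc x                              ∎))
  where open ℕₚ.≤-Reasoning

∣-exponents⇒sum-≥ : ∀ n (m : Fin n → ℕ) (e : Vec ℕ n) → (∀ j → m j ∣ suc (lookup e j)) →
  e ≢ tabulate (λ j → m j ∸ 1) →
  ∃ λ i → sumℕ n (λ j → m j ∸ 1) +ℕ m i ≤ sumℕ n (lookup e)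
∣-exponents⇒sum-≥ n m e m∣ e≢ = i , sum-map-+-≤ pred≤ (m i) (∈-allFin i) excess
  where
    differs : ∃ λ i → lookup e i ≢ m i ∸ 1
    differs = Finₚ.¬∀⟶∃¬ n _ (λ i → lookup e i ℕₚ.≟ m i ∸ 1)
      (λ e≗ → e≢ (≡.trans (≡.sym (Vecₚ.tabulate∘lookup e)) (Vecₚ.tabulate-cong e≗)))
    i = proj₁ differs
    pred≤ : ∀ j → m j ∸ 1 ≤ lookup e j
    pred≤ j = ℕₚ.∸-monoˡ-≤ 1 (∣⇒≤ (m∣ j))
    excess : m i ∸ 1 +ℕ m i ≤ lookup e i
    excess with ∣suc⇒≡pred⊎≥ (m∣ i)
    ... | inj₁ eq = contradiction eq (proj₂ differs)
    ... | inj₂ ge = ge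

nondividing-index : ∀ n (m : Fin n → ℕ) → (∀ i → 1 ≤ m i) → (e : Vec ℕ n) →
  e ≢ tabulate (λ i → m i ∸ 1) →
  sumℕ n (lookup e) ≤ sumℕ n (λ i → m i ∸ 1) +ℕ minℕ n m ∸ 1 →
  ∃ λ j → ¬ (m j ∣ suc (lookup e j))
nondividing-index n m m≥1 e e≢ bound =
  Finₚ.¬∀⟶∃¬ n _ (λ j → m j ∣? suc (lookup e j)) all-divide-impossible
  where
    S = sumℕ n (λ j → m j ∸ 1)
    all-divide-impossible : ¬ (∀ j → m j ∣ suc (lookup e j))
    all-divide-impossible m∣ with ∣-exponents⇒sum-≥ n m e m∣ e≢
    ... | i , large = ℕₚ.<-irrefl ≡.refl (begin-strict
      S +ℕ m i           ≤⟨ large ⟩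
      sumℕ n (lookup e)  ≤⟨ bound ⟩
      S +ℕ minℕ n m ∸ 1  ≤⟨ ℕₚ.∸-monoˡ-≤ 1 (ℕₚ.+-monoʳ-≤ S (minℕ-≤ n m i)) ⟩
      S +ℕ m i ∸ 1       <⟨ ℕₚ.∸-monoʳ-< ℕₚ.0<1+n (ℕₚ.≤-trans (m≥1 i) (ℕₚ.m≤n+m (m i) S)) ⟩
      S +ℕ m i           ∎)
      where open ℕₚ.≤-Reasoning

foldr-map-tabulate : ∀ {a b} {A : Set a} {B : Set b} (_∙_ : B → B → B) (ε : B) {n}
  (g : A → B) (h : Fin n → A) → foldr _∙_ ε (map g (List.tabulate h)) ≡ VF.foldr _∙_ ε (g ∘ h)
foldr-map-tabulate _∙_ ε {zero}  g h = ≡.refl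
foldr-map-tabulate _∙_ ε {suc n} g h = ≡.cong (g (h Fin.zero) ∙_) (foldr-map-tabulate _∙_ ε g (h ∘ Fin.suc))

module _ {c ℓ} (F : Field c ℓ) where
  open Field F
  open FieldDefs F
  open import Relation.Binary.Reasoning.Setoid setoid
  open import Algebra.Properties.Ring ring using (x∙y⁻¹≈ε⇒x≈y; x≈y⇒x∙y⁻¹≈ε; [y-z]x≈yx-zx; +-cancelʳ)
  open import Algebra.Properties.CommutativeSemiring.Exp commutativeSemiring
    using (_^_; ^-congˡ; ^-homo-*; ^-assocʳ; ^-distrib-*)
  open import Algebra.Properties.Semiring.Mult semiring using (_×_; ×1-homo-*)
  open import Algebra.Properties.CommutativeSemigroup *-commutativeSemigroup using (x∙yz≈y∙xz)
  open import Algebra.Solver.Ring.NaturalCoefficients.Default commutativeSemiring using (solve; _:=_; _:+_; _:*_; con)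
  module Σ+ = Algebra.Properties.Semiring.Sum semiring
  module Σ* = Algebra.Properties.CommutativeMonoid.Sum *-commutativeMonoid

  ∑ : ∀ {n} → Vector Carrier n → Carrier
  ∑ = Σ+.sum

  ∏ : ∀ {n} → Vector Carrier n → Carrier
  ∏ = Σ*.sum

  x*y≈0⇒y≈0 : ∀ {x y} → x * y ≈ 0# → ¬ x ≈ 0# → y ≈ 0#
  x*y≈0⇒y≈0 {x} {y} xy≈0 x≉0 = begin
    y                      ≈⟨ *-identityˡ y ⟨
    1# * y                 ≈⟨ *-congʳ (trans (sym x*x⁻¹≈1) (*-comm x (x ⁻¹[ x≉0 ]))) ⟩
    x ⁻¹[ x≉0 ] * x * y    ≈⟨ *-assoc _ x y ⟩
    x ⁻¹[ x≉0 ] * (x * y)  ≈⟨ *-congˡ xy≈0 ⟩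
    x ⁻¹[ x≉0 ] * 0#       ≈⟨ zeroʳ _ ⟩
    0#                     ∎
    where x*x⁻¹≈1 = proj₂ (inverse x x≉0)

  *-≉0 : ∀ {x y} → ¬ x ≈ 0# → ¬ y ≈ 0# → ¬ x * y ≈ 0#
  *-≉0 x≉0 y≉0 xy≈0 = y≉0 (x*y≈0⇒y≈0 xy≈0 x≉0)

  x*z≈y*z⇒[x-y]*z≈0 : ∀ {x y z} → x * z ≈ y * z → (x - y) * z ≈ 0#
  x*z≈y*z⇒[x-y]*z≈0 {x} {y} {z} eq = trans ([y-z]x≈yx-zx z x y) (x≈y⇒x∙y⁻¹≈ε eq)

  *-cancelʳ-≉0 : ∀ {x y z} → ¬ z ≈ 0# → x * z ≈ y * z → x ≈ y
  *-cancelʳ-≉0 {x} {y} {z} z≉0 eq =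
    x∙y⁻¹≈ε⇒x≈y x y (x*y≈0⇒y≈0 (trans (*-comm z (x - y)) (x*z≈y*z⇒[x-y]*z≈0 eq)) z≉0)

  x*z≈y*z⇒z≈0 : ∀ {x y z} → ¬ x ≈ y → x * z ≈ y * z → z ≈ 0#
  x*z≈y*z⇒z≈0 {x} {y} x≉y eq = x*y≈0⇒y≈0 (x*z≈y*z⇒[x-y]*z≈0 eq) (x≉y ∘ x∙y⁻¹≈ε⇒x≈y x y)

  x*y≈z⇒y≈x⁻¹*z : ∀ {x y z} (x≉0 : ¬ x ≈ 0#) → x * y ≈ z → y ≈ x ⁻¹[ x≉0 ] * z
  x*y≈z⇒y≈x⁻¹*z {x} {y} {z} x≉0 xy≈z = *-cancelʳ-≉0 x≉0 (begin
    y * x                   ≈⟨ *-comm y x ⟩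
    x * y                   ≈⟨ xy≈z ⟩
    z                       ≈⟨ *-identityˡ z ⟨
    1# * z                  ≈⟨ *-congʳ (proj₂ (inverse x x≉0)) ⟨
    x * x ⁻¹[ x≉0 ] * z     ≈⟨ solve 3 (λ x x' z → x :* x' :* z := x' :* z :* x) refl x (x ⁻¹[ x≉0 ]) z ⟩
    x ⁻¹[ x≉0 ] * z * x     ∎)

  pow≡^ : ∀ x k → pow x k ≡ x ^ k
  pow≡^ x zero    = ≡.refl
  pow≡^ x (suc k) = ≡.cong (x *_) (pow≡^ x k)

  natF≡×1 : ∀ k → natF k ≡ k × 1#
  natF≡×1 zero    = ≡.refl
  natF≡×1 (suc k) = ≡.cong (1# +_) (natF≡×1 k)

  1^k≈1 : ∀ k → 1# ^ k ≈ 1#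
  1^k≈1 zero    = refl
  1^k≈1 (suc k) = trans (*-identityˡ _) (1^k≈1 k)

  prodF≡∏ : ∀ n (g : Vector Carrier n) → prodF n g ≡ ∏ g
  prodF≡∏ n g = foldr-map-tabulate _*_ 1# g id

  ∏-≉0 : ∀ {n} (g : Vector Carrier n) → (∀ i → ¬ g i ≈ 0#) → ¬ ∏ g ≈ 0#
  ∏-≉0 {zero}  g g≉0 1≈0 = 0≉1 (sym 1≈0)
  ∏-≉0 {suc n} g g≉0 = *-≉0 (g≉0 Fin.zero) (∏-≉0 (g ∘ Fin.suc) (g≉0 ∘ Fin.suc))

  ∏-≈0 : ∀ {n} (g : Vector Carrier n) i → g i ≈ 0# → ∏ g ≈ 0#
  ∏-≈0 g Fin.zero    gi≈0 = trans (*-congʳ gi≈0) (zeroˡ _)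
  ∏-≈0 g (Fin.suc i) gi≈0 = trans (*-congˡ (∏-≈0 (g ∘ Fin.suc) i gi≈0)) (zeroʳ _)

  ∏-scale : ∀ {n} x (g : Vector Carrier n) → ∏ (λ i → x * g i) ≈ x ^ n * ∏ g
  ∏-scale {n} x g = trans (Σ*.∑-distrib-+ (λ _ → x) g) (*-congʳ (Σ*.sum-replicate n))

  natF-* : ∀ a b → natF (a ℕ.* b) ≈ natF a * natF b
  natF-* a b = begin
    natF (a ℕ.* b)   ≡⟨ natF≡×1 (a ℕ.* b) ⟩
    (a ℕ.* b) × 1#   ≈⟨ ×1-homo-* a b ⟩
    a × 1# * b × 1#  ≡⟨ ≡.cong₂ _*_ (natF≡×1 a) (natF≡×1 b) ⟨
    natF a * natF b  ∎

  natF-prodℕ : ∀ n (m : Fin n → ℕ) → natF (prodℕ n m) ≈ ∏ (natF ∘ m)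
  natF-prodℕ n m = begin
    natF (prodℕ n m)           ≡⟨ ≡.cong natF (foldr-map-tabulate ℕ._*_ 1 m id) ⟩
    natF (VF.foldr ℕ._*_ 1 m)  ≈⟨ natF-∏ n m ⟩
    ∏ (natF ∘ m)               ∎
    where
      natF-∏ : ∀ n (m : Fin n → ℕ) → natF (VF.foldr ℕ._*_ 1 m) ≈ ∏ (natF ∘ m)
      natF-∏ zero    m = +-identityʳ 1#
      natF-∏ (suc n) m = trans (natF-* (m Fin.zero) _) (*-congˡ (natF-∏ n (m ∘ Fin.suc)))

  prodF[x]*prodF[x^e]≈∏x^[1+e] : ∀ n (x : Vector Carrier n) (e : Fin n → ℕ) →
    prodF n x * prodF n (λ i → pow (x i) (e i)) ≈ ∏ (λ i → x i ^ suc (e i))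
  prodF[x]*prodF[x^e]≈∏x^[1+e] n x e = begin
    prodF n x * prodF n (λ i → pow (x i) (e i))  ≡⟨ ≡.cong₂ _*_ (prodF≡∏ n x) (prodF≡∏ n _) ⟩
    ∏ x * ∏ (λ i → pow (x i) (e i))              ≈⟨ Σ*.∑-distrib-+ x _ ⟨
    ∏ (λ i → x i * pow (x i) (e i))              ≡⟨ Σ*.sum-cong-≗ (λ i → ≡.cong (x i *_) (pow≡^ (x i) (e i))) ⟩
    ∏ (λ i → x i ^ suc (e i))                    ∎

  -- Univariate polynomials as coefficient lists

  horner : List Carrier → Carrier → Carrier
  horner []       x = 0#
  horner (a ∷ as) x = a + x * horner as x

  horner-cong : ∀ p {x y} → x ≈ y → horner p x ≈ horner p y
  horner-cong []      x≈y = refl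
  horner-cong (a ∷ p) x≈y = +-congˡ (*-cong x≈y (horner-cong p x≈y))

  a+x*0≈a : ∀ a x → a + x * 0# ≈ a
  a+x*0≈a a x = trans (+-congˡ (zeroʳ x)) (+-identityʳ a)

  quotient : Carrier → List Carrier → List Carrier
  quotient a []           = []
  quotient a (_ ∷ [])     = []
  quotient a (_ ∷ b ∷ bs) = horner (b ∷ bs) a ∷ quotient a (b ∷ bs)

  -- p(x) − p(a) = (x − a)·q(x), with both sides moved so that no subtraction occurs.
  horner-quotient : ∀ a p x →
    horner p x + a * horner (quotient a p) x ≈ x * horner (quotient a p) x + horner p a
  horner-quotient a []       x = solve 2 (λ x a → con 0 :+ a :* con 0 := x :* con 0 :+ con 0) refl x a
  horner-quotient a (b ∷ []) x =
    solve 3 (λ x a b → b :+ x :* con 0 :+ a :* con 0 := x :* con 0 :+ (b :+ a :* con 0)) refl x a b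
  horner-quotient a (b ∷ c ∷ cs) x = begin
    (b + x * P) + a * (Pa + x * Q)
      ≈⟨ solve 6 (λ x a b P Pa Q → (b :+ x :* P) :+ a :* (Pa :+ x :* Q)
                                  := (b :+ a :* Pa) :+ x :* (P :+ a :* Q)) refl x a b P Pa Q ⟩
    (b + a * Pa) + x * (P + a * Q)
      ≈⟨ +-congˡ (*-congˡ (horner-quotient a (c ∷ cs) x)) ⟩
    (b + a * Pa) + x * (x * Q + Pa)
      ≈⟨ solve 5 (λ x a b Pa Q → (b :+ a :* Pa) :+ x :* (x :* Q :+ Pa)
                                := x :* (Pa :+ x :* Q) :+ (b :+ a :* Pa)) refl x a b Pa Q ⟩
    x * (Pa + x * Q) + (b + a * Pa)
      ∎
    where
      P  = horner (c ∷ cs) x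
      Pa = horner (c ∷ cs) a
      Q  = horner (quotient a (c ∷ cs)) x

  All≈0-quotient⇒All≈0 : ∀ a p → All (_≈ 0#) (quotient a p) → horner p a ≈ 0# → All (_≈ 0#) p
  All≈0-quotient⇒All≈0 a []           _           _    = []
  All≈0-quotient⇒All≈0 a (b ∷ [])     _           pa≈0 = trans (sym (a+x*0≈a b a)) pa≈0 ∷ []
  All≈0-quotient⇒All≈0 a (b ∷ c ∷ cs) (qa≈0 ∷ q≈0) pa≈0 =
    trans (sym (trans (+-congˡ (*-congˡ qa≈0)) (a+x*0≈a b a))) pa≈0 ∷ All≈0-quotient⇒All≈0 a (c ∷ cs) q≈0 qa≈0

  length-quotient : ∀ a p {d} → List.length p ≤ suc d → List.length (quotient a p) ≤ d
  length-quotient a []           _         = z≤n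
  length-quotient a (_ ∷ [])     _         = z≤n
  length-quotient a (_ ∷ c ∷ cs) (s≤s len) = ℕₚ.≤-trans (s≤s (length-quotient a (c ∷ cs) ℕₚ.≤-refl)) len

  distinct-roots⇒All≈0 : ∀ d p → List.length p ≤ d → (x : Fin d → Carrier) →
    (∀ i j → x i ≈ x j → i ≡ j) → (∀ i → horner p (x i) ≈ 0#) → All (_≈ 0#) p
  distinct-roots⇒All≈0 zero    []      _   x x-inj p[x]≈0 = []
  distinct-roots⇒All≈0 (suc d) p       len x x-inj p[x]≈0 =
    All≈0-quotient⇒All≈0 a p
      (distinct-roots⇒All≈0 d (quotient a p) (length-quotient a p len) (x ∘ Fin.suc)
        (λ i j → Finₚ.suc-injective ∘ x-inj _ _) q[x]≈0)
      (p[x]≈0 Fin.zero)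
    where
      a = x Fin.zero
      q[x]≈0 : ∀ i → horner (quotient a p) (x (Fin.suc i)) ≈ 0#
      q[x]≈0 i = x*z≈y*z⇒z≈0 (λ a≈b → Finₚ.0≢1+n (x-inj _ _ a≈b)) (begin
        a * Q               ≈⟨ +-identityˡ _ ⟨
        0# + a * Q          ≈⟨ +-congʳ (p[x]≈0 (Fin.suc i)) ⟨
        horner p b + a * Q  ≈⟨ horner-quotient a p b ⟩
        b * Q + horner p a  ≈⟨ +-congˡ (p[x]≈0 Fin.zero) ⟩
        b * Q + 0#          ≈⟨ +-identityʳ _ ⟩
        b * Q               ∎)
        where
          b = x (Fin.suc i)
          Q = horner (quotient a p) b

  monomial : ℕ → Carrier → List Carrier
  monomial zero    s = s ∷ []
  monomial (suc r) s = 0# ∷ monomial r s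

  horner-monomial : ∀ r s x → horner (monomial r s) x ≈ x ^ r * s
  horner-monomial zero    s x = trans (a+x*0≈a s x) (sym (*-identityˡ s))
  horner-monomial (suc r) s x =
    trans (+-identityˡ _) (trans (*-congˡ (horner-monomial r s x)) (sym (*-assoc x _ s)))

  length-monomial : ∀ r s → List.length (monomial r s) ≡ suc r
  length-monomial zero    s = ≡.refl
  length-monomial (suc r) s = ≡.cong suc (length-monomial r s)

  All≈0-monomial⇒≈0 : ∀ r s → All (_≈ 0#) (monomial r s) → s ≈ 0#
  All≈0-monomial⇒≈0 zero    s (s≈0 ∷ _) = s≈0
  All≈0-monomial⇒≈0 (suc r) s (_ ∷ ms≈0) = All≈0-monomial⇒≈0 r s ms≈0

  horner-replicate-1 : ∀ k → horner (List.replicate k 1#) 1# ≈ natF k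
  horner-replicate-1 zero    = refl
  horner-replicate-1 (suc k) = +-congˡ (trans (*-identityˡ _) (horner-replicate-1 k))

  geometric-series : ∀ k x →
    x * horner (List.replicate k 1#) x + 1# ≈ horner (List.replicate k 1#) x + x ^ k
  geometric-series zero    x = +-congʳ (zeroʳ x)
  geometric-series (suc k) x = begin
    x * (1# + x * P) + 1#       ≈⟨ solve 2 (λ x P → x :* (con 1 :+ x :* P) :+ con 1 := con 1 :+ x :* (x :* P :+ con 1)) refl x P ⟩
    1# + x * (x * P + 1#)       ≈⟨ +-congˡ (*-congˡ (geometric-series k x)) ⟩
    1# + x * (P + x ^ k)        ≈⟨ solve 3 (λ x P X → con 1 :+ x :* (P :+ X) := (con 1 :+ x :* P) :+ x :* X) refl x P (x ^ k) ⟩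
    (1# + x * P) + x * x ^ k    ∎
    where P = horner (List.replicate k 1#) x

  ¬All≈0-replicate-1 : ∀ k → 1 ≤ k → ¬ All (_≈ 0#) (List.replicate k 1#)
  ¬All≈0-replicate-1 (suc k) _ (1≈0 ∷ _) = 0≉1 (sym 1≈0)

  -- Finite subgroups of F*

  module FiniteSubgroupProperties (G : FiniteSubgroup) where
    m : ℕ
    m = size G

    x : Fin m → Carrier
    x = elem G

    instance
      m-nonZero : ℕ.NonZero m
      m-nonZero = Finₚ.nonZeroIndex (proj₁ (has-one G))

    m≥1 : 1 ≤ m
    m≥1 = ℕ.>-nonZero⁻¹ m

    _·_ : Fin m → Fin m → Fin m
    i · j = proj₁ (mul-closed G i j)

    x[i·j]≈x[i]*x[j] : ∀ i j → x (i · j) ≈ x i * x j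
    x[i·j]≈x[i]*x[j] i j = sym (proj₂ (mul-closed G i j))

    _⁻¹ : Fin m → Fin m
    i ⁻¹ = proj₁ (inv-closed G i)

    ·-inverse : ∀ i j → x i * x j ≈ 1# → ∀ k → i · (j · k) ≡ k
    ·-inverse i j xixj≈1 k = distinct G _ _ (begin
      x (i · (j · k))      ≈⟨ x[i·j]≈x[i]*x[j] i _ ⟩
      x i * x (j · k)      ≈⟨ *-congˡ (x[i·j]≈x[i]*x[j] j k) ⟩
      x i * (x j * x k)    ≈⟨ *-assoc _ _ _ ⟨
      (x i * x j) * x k    ≈⟨ *-congʳ xixj≈1 ⟩
      1# * x k             ≈⟨ *-identityˡ _ ⟩
      x k                  ∎)

    translation : Fin m → Permutation m m
    translation i = permutation (i ·_) (i ⁻¹ ·_)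
      (·-inverse i (i ⁻¹) (proj₂ (inv-closed G i)))
      (·-inverse (i ⁻¹) i (trans (*-comm _ _) (proj₂ (inv-closed G i))))

    module _ {a ℓ′} (M : CommutativeMonoid a ℓ′) where
      open CommutativeMonoid M using () renaming (Carrier to M₀; _≈_ to _≈ᴹ_; trans to transᴹ)
      module ΣM = Algebra.Properties.CommutativeMonoid.Sum M

      sum-translate : (φ : Carrier → M₀) → (∀ {y z} → y ≈ z → φ y ≈ᴹ φ z) →
                      ∀ i → ΣM.sum (φ ∘ x) ≈ᴹ ΣM.sum (λ j → φ (x i * x j))
      sum-translate φ φ-cong i =
        transᴹ (ΣM.sum-permute (φ ∘ x) (translation i)) (ΣM.sum-cong-≋ (λ j → φ-cong (x[i·j]≈x[i]*x[j] i j)))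

    x^m≈1 : ∀ i → x i ^ m ≈ 1#
    x^m≈1 i = *-cancelʳ-≉0 (∏-≉0 x (nonzero G)) (begin
      x i ^ m * ∏ x          ≈⟨ ∏-scale (x i) x ⟨
      ∏ (λ j → x i * x j)    ≈⟨ sum-translate *-commutativeMonoid id id i ⟨
      ∏ x                    ≈⟨ *-identityˡ _ ⟨
      1# * ∏ x               ∎)

    powerSum : ℕ → Carrier
    powerSum k = ∑ (λ i → x i ^ k)

    Σ'-elems : ∀ g → Σ' (map g (elems G)) ≡ ∑ (g ∘ x)
    Σ'-elems g = ≡.trans (≡.cong Σ' (≡.sym (Listₚ.map-∘ (List.allFin m)))) (foldr-map-tabulate _+_ 0# (g ∘ x) id)

    powerSum-invariant : ∀ i k → x i ^ k * powerSum k ≈ powerSum k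
    powerSum-invariant i k = sym (begin
      powerSum k                         ≈⟨ sum-translate +-commutativeMonoid (_^ k) (^-congˡ k) i ⟩
      ∑ (λ j → (x i * x j) ^ k)          ≈⟨ Σ+.sum-cong-≋ (λ j → ^-distrib-* (x i) (x j) k) ⟩
      ∑ (λ j → x i ^ k * x j ^ k)        ≈⟨ Σ+.*-distribˡ-sum (x i ^ k) (λ j → x j ^ k) ⟨
      x i ^ k * powerSum k               ∎)

    powerSum-size : powerSum m ≈ natF m
    powerSum-size = begin
      ∑ (λ i → x i ^ m)      ≈⟨ Σ+.sum-cong-≋ {m} x^m≈1 ⟩
      ∑ {m} (λ _ → 1#)       ≈⟨ Σ+.sum-replicate m ⟩
      m × 1#                 ≡⟨ natF≡×1 m ⟨
      natF m                 ∎

    natF-size≉0 : ¬ natF m ≈ 0#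
    natF-size≉0 m≈0 = ¬All≈0-replicate-1 m m≥1
      (distinct-roots⇒All≈0 m ones (ℕₚ.≤-reflexive (Listₚ.length-replicate m)) x (distinct G) ones[x]≈0)
      where
        ones = List.replicate m 1#
        one = proj₁ (has-one G)
        x[one]≈1 = proj₂ (has-one G)
        ones[x]≈0 : ∀ i → horner ones (x i) ≈ 0#
        ones[x]≈0 i with i Finₚ.≟ one
        ... | yes ≡.refl = trans (horner-cong ones x[one]≈1) (trans (horner-replicate-1 m) m≈0)
        ... | no i≢one = x*z≈y*z⇒z≈0 (λ xi≈1 → i≢one (distinct G _ _ (trans xi≈1 (sym x[one]≈1)))) (begin
          x i * horner ones (x i)  ≈⟨ +-cancelʳ 1# _ _ (trans (geometric-series m (x i)) (+-congˡ (x^m≈1 i))) ⟩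
          horner ones (x i)        ≈⟨ *-identityˡ _ ⟨
          1# * horner ones (x i)   ∎)

    ^-invariant⇒≈0 : ∀ r s → 0 < r → r < m → (∀ i → x i ^ r * s ≈ s) → s ≈ 0#
    ^-invariant⇒≈0 (suc r) s _ r<m x^r*s≈s =
      All≈0-monomial⇒≈0 r s (tail (distinct-roots⇒All≈0 m p length≤m x (distinct G) p[x]≈0))
      where
        -- the coefficient list of s·X^(r+1) − s
        p = - s ∷ monomial r s
        length≤m : List.length p ≤ m
        length≤m = ℕₚ.≤-trans (s≤s (ℕₚ.≤-reflexive (length-monomial r s))) r<m
        tail : All (_≈ 0#) p → All (_≈ 0#) (monomial r s)
        tail (_ ∷ ms≈0) = ms≈0
        p[x]≈0 : ∀ i → horner p (x i) ≈ 0#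
        p[x]≈0 i = begin
          - s + x i * horner (monomial r s) (x i)  ≈⟨ +-congˡ (*-congˡ (horner-monomial r s (x i))) ⟩
          - s + x i * (x i ^ r * s)                ≈⟨ +-congˡ (*-assoc _ _ _) ⟨
          - s + x i ^ suc r * s                    ≈⟨ +-congˡ (x^r*s≈s i) ⟩
          - s + s                                  ≈⟨ -‿inverseˡ s ⟩
          0#                                       ∎

    powerSum≈0 : ∀ k → ¬ m ∣ k → powerSum k ≈ 0#
    powerSum≈0 k m∤k = ^-invariant⇒≈0 (k % m) (powerSum k)
      (ℕₚ.n≢0⇒n>0 (m∤k ∘ m%n≡0⇒n∣m k m)) (m%n<n k m)
      (λ i → trans (*-congʳ (x^[k%m]≈x^k i)) (powerSum-invariant i k))
      where
        x^[k%m]≈x^k : ∀ i → x i ^ (k % m) ≈ x i ^ k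
        x^[k%m]≈x^k i = sym (begin
          x i ^ k                               ≡⟨ ≡.cong (x i ^_) (m≡m%n+[m/n]*n k m) ⟩
          x i ^ (k % m +ℕ k / m ℕ.* m)          ≈⟨ ^-homo-* (x i) (k % m) _ ⟩
          x i ^ (k % m) * x i ^ (k / m ℕ.* m)   ≡⟨ ≡.cong (λ e → x i ^ (k % m) * x i ^ e) (ℕₚ.*-comm (k / m) m) ⟩
          x i ^ (k % m) * x i ^ (m ℕ.* (k / m)) ≈⟨ *-congˡ (^-assocʳ (x i) m (k / m)) ⟨
          x i ^ (k % m) * (x i ^ m) ^ (k / m)   ≈⟨ *-congˡ (trans (^-congˡ (k / m) (x^m≈1 i)) (1^k≈1 (k / m))) ⟩
          x i ^ (k % m) * 1#                    ≈⟨ *-identityʳ _ ⟩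
          x i ^ (k % m)                         ∎)

  module _ {a} {X : Set a} where
    Σ'-cong : {f g : X → Carrier} → (∀ x → f x ≈ g x) → ∀ xs → Σ' (map f xs) ≈ Σ' (map g xs)
    Σ'-cong f≈g []       = refl
    Σ'-cong f≈g (x ∷ xs) = +-cong (f≈g x) (Σ'-cong f≈g xs)

    Σ'-distribˡ : ∀ k (f : X → Carrier) xs → Σ' (map (λ x → k * f x) xs) ≈ k * Σ' (map f xs)
    Σ'-distribˡ k f []       = sym (zeroʳ k)
    Σ'-distribˡ k f (x ∷ xs) = trans (+-congˡ (Σ'-distribˡ k f xs)) (sym (distribˡ k _ _))

    Σ'-distribʳ : ∀ k (f : X → Carrier) xs → Σ' (map (λ x → f x * k) xs) ≈ Σ' (map f xs) * k
    Σ'-distribʳ k f []       = sym (zeroˡ k)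
    Σ'-distribʳ k f (x ∷ xs) = trans (+-congˡ (Σ'-distribʳ k f xs)) (sym (distribʳ k _ _))

    Σ'-+ : ∀ (f g : X → Carrier) xs → Σ' (map (λ x → f x + g x) xs) ≈ Σ' (map f xs) + Σ' (map g xs)
    Σ'-+ f g []       = sym (+-identityʳ 0#)
    Σ'-+ f g (x ∷ xs) = trans (+-congˡ (Σ'-+ f g xs))
      (solve 4 (λ a b c d → (a :+ b) :+ (c :+ d) := (a :+ c) :+ (b :+ d)) refl (f x) (g x) _ _)

    Σ'-zero : ∀ (xs : List X) → Σ' (map (λ _ → 0#) xs) ≈ 0#
    Σ'-zero []       = refl
    Σ'-zero (x ∷ xs) = trans (+-identityˡ _) (Σ'-zero xs)

    Σ'-++ : ∀ (f : X → Carrier) xs ys → Σ' (map f (xs List.++ ys)) ≈ Σ' (map f xs) + Σ' (map f ys)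
    Σ'-++ f []       ys = sym (+-identityˡ _)
    Σ'-++ f (x ∷ xs) ys = trans (+-congˡ (Σ'-++ f xs ys)) (sym (+-assoc _ _ _))

  Σ'-comm : ∀ {a b} {X : Set a} {Y : Set b} (h : X → Y → Carrier) xs ys →
    Σ' (map (λ x → Σ' (map (h x) ys)) xs) ≈ Σ' (map (λ y → Σ' (map (λ x → h x y) xs)) ys)
  Σ'-comm h []       ys = sym (Σ'-zero ys)
  Σ'-comm h (x ∷ xs) ys = trans (+-congˡ (Σ'-comm h xs ys)) (sym (Σ'-+ (h x) _ ys))

  Σ'-concatMap : ∀ {a b} {X : Set a} {Y : Set b} (f : Y → Carrier) (h : X → List Y) xs →
    Σ' (map f (List.concatMap h xs)) ≈ Σ' (map (λ x → Σ' (map f (h x))) xs)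
  Σ'-concatMap f h []       = refl
  Σ'-concatMap f h (x ∷ xs) = trans (Σ'-++ f (h x) _) (+-congˡ (Σ'-concatMap f h xs))

  Σ'-grid-∏ : ∀ n (A : Fin n → List Carrier) (g : Fin n → Carrier → Carrier) →
    Σ' (map (λ a → ∏ (λ i → g i (a i))) (grid n A)) ≈ ∏ (λ i → Σ' (map (g i) (A i)))
  Σ'-grid-∏ zero    A g = +-identityʳ 1#
  Σ'-grid-∏ (suc n) A g = begin
    Σ' (map φ (List.concatMap (λ x → map (x VF.∷_) Γ) (A Fin.zero)))
      ≈⟨ Σ'-concatMap φ _ (A Fin.zero) ⟩
    Σ' (map (λ x → Σ' (map φ (map (x VF.∷_) Γ))) (A Fin.zero))
      ≡⟨ ≡.cong Σ' (Listₚ.map-cong (λ x → ≡.cong Σ' (≡.sym (Listₚ.map-∘ Γ))) (A Fin.zero)) ⟩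
    Σ' (map (λ x → Σ' (map (λ a → g Fin.zero x * ψ a) Γ)) (A Fin.zero))
      ≈⟨ Σ'-cong (λ x → Σ'-distribˡ (g Fin.zero x) ψ Γ) (A Fin.zero) ⟩
    Σ' (map (λ x → g Fin.zero x * Σ' (map ψ Γ)) (A Fin.zero))
      ≈⟨ Σ'-distribʳ (Σ' (map ψ Γ)) (g Fin.zero) (A Fin.zero) ⟩
    Σ' (map (g Fin.zero) (A Fin.zero)) * Σ' (map ψ Γ)
      ≈⟨ *-congˡ (Σ'-grid-∏ n (A ∘ Fin.suc) (g ∘ Fin.suc)) ⟩
    ∏ (λ i → Σ' (map (g i) (A i)))
      ∎
    where
      φ : Vector Carrier (suc n) → Carrier
      φ a = ∏ (λ i → g i (a i))
      Γ = grid n (A ∘ Fin.suc)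
      ψ : Vector Carrier n → Carrier
      ψ a = ∏ (λ i → g (Fin.suc i) (a i))

  -- Linear functionals on F[X₁, …, Xₙ]

  module _ {n : ℕ} where
    linearExtension : (Vec ℕ n → Carrier) → Poly n → Carrier
    linearExtension Ψ f = Σ' (map (λ (c , e) → c * Ψ e) f)

    exponent≢? : ∀ e (t : Σ Carrier (λ _ → Vec ℕ n)) → Dec (proj₂ t ≢ e)
    exponent≢? e (_ , e′) = ¬? (≡-dec ℕₚ._≟_ e′ e)

    removeMonomial : Vec ℕ n → Poly n → Poly n
    removeMonomial e = List.filter (exponent≢? e)

    linearExtension-split : ∀ Ψ e f →
      linearExtension Ψ f ≈ coeff f e * Ψ e + linearExtension Ψ (removeMonomial e f)
    linearExtension-split Ψ e [] = sym (trans (+-identityʳ _) (zeroˡ _))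
    linearExtension-split Ψ e ((a , e′) ∷ f) with ≡-dec ℕₚ._≟_ e′ e
    ... | yes ≡.refl = begin
      a * Ψ e + linearExtension Ψ f             ≈⟨ +-congˡ (linearExtension-split Ψ e f) ⟩
      a * Ψ e + (coeff f e * Ψ e + R)           ≈⟨ +-assoc _ _ _ ⟨
      (a * Ψ e + coeff f e * Ψ e) + R           ≈⟨ +-congʳ (distribʳ _ _ _) ⟨
      (a + coeff f e) * Ψ e + R                 ∎
      where R = linearExtension Ψ (removeMonomial e f)
    ... | no _ = begin
      a * Ψ e′ + linearExtension Ψ f            ≈⟨ +-congˡ (linearExtension-split Ψ e f) ⟩
      a * Ψ e′ + (coeff f e * Ψ e + R)          ≈⟨ solve 3 (λ x y z → x :+ (y :+ z) := y :+ (x :+ z)) refl (a * Ψ e′) (coeff f e * Ψ e) R ⟩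
      coeff f e * Ψ e + (a * Ψ e′ + R)          ∎
      where R = linearExtension Ψ (removeMonomial e f)

    coeff-cons-≢ : ∀ a (f : Poly n) {e e′} → e′ ≢ e → coeff ((a , e′) ∷ f) e ≈ coeff f e
    coeff-cons-≢ a f {e} {e′} e′≢e with ≡-dec ℕₚ._≟_ e′ e
    ... | yes e′≡e = contradiction e′≡e e′≢e
    ... | no _     = refl

    coeff-cons-cong : ∀ a e′ {f g : Poly n} e → coeff f e ≈ coeff g e →
                      coeff ((a , e′) ∷ f) e ≈ coeff ((a , e′) ∷ g) e
    coeff-cons-cong a e′ e f≈g with ≡-dec ℕₚ._≟_ e′ e
    ... | yes _ = +-congˡ f≈g
    ... | no _  = f≈g

    coeff-removeMonomial-≡ : ∀ e f → coeff (removeMonomial e f) e ≈ 0#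
    coeff-removeMonomial-≡ e [] = refl
    coeff-removeMonomial-≡ e ((a , e′) ∷ f) with ≡-dec ℕₚ._≟_ e′ e
    ... | yes _    = coeff-removeMonomial-≡ e f
    ... | no e′≢e  = trans (coeff-cons-≢ a _ e′≢e) (coeff-removeMonomial-≡ e f)

    coeff-removeMonomial-≢ : ∀ e f {e′} → e′ ≢ e → coeff (removeMonomial e f) e′ ≈ coeff f e′
    coeff-removeMonomial-≢ e [] e′≢e = refl
    coeff-removeMonomial-≢ e ((a , e″) ∷ f) {e′} e′≢e with ≡-dec ℕₚ._≟_ e″ e
    ... | yes ≡.refl = trans (coeff-removeMonomial-≢ e f e′≢e) (sym (coeff-cons-≢ a f (e′≢e ∘ ≡.sym)))
    ... | no _       = coeff-cons-cong a e″ e′ (coeff-removeMonomial-≢ e f e′≢e)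

    vanishing-removeMonomial : ∀ (Ψ : Vec ℕ n → Carrier) e (f : Poly n) → (∀ e′ → e′ ≢ e → Ψ e′ ≈ 0# ⊎ coeff f e′ ≈ 0#) →
                               ∀ e′ → Ψ e′ ≈ 0# ⊎ coeff (removeMonomial e f) e′ ≈ 0#
    vanishing-removeMonomial Ψ e f vanish e′ with ≡-dec ℕₚ._≟_ e′ e
    ... | yes ≡.refl = inj₂ (coeff-removeMonomial-≡ e f)
    ... | no e′≢e    = Sum.map₂ (trans (coeff-removeMonomial-≢ e f e′≢e)) (vanish e′ e′≢e)

    linearExtension≈0 : ∀ (Ψ : Vec ℕ n → Carrier) (f : Poly n) → (∀ e → Ψ e ≈ 0# ⊎ coeff f e ≈ 0#) → linearExtension Ψ f ≈ 0#
    linearExtension≈0 Ψ f = go (List.length f) f ℕₚ.≤-refl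
      where
        go : ∀ k (f : Poly n) → List.length f ≤ k → (∀ e → Ψ e ≈ 0# ⊎ coeff f e ≈ 0#) → linearExtension Ψ f ≈ 0#
        go _       []                  _         _      = refl
        go (suc k) f@((_ , e) ∷ rest) (s≤s len) vanish = begin
          linearExtension Ψ f                                        ≈⟨ linearExtension-split Ψ e f ⟩
          coeff f e * Ψ e + linearExtension Ψ (removeMonomial e f)   ≈⟨ +-cong term≈0 (go k (removeMonomial e f) shorter vanish′) ⟩
          0# + 0#                                                    ≈⟨ +-identityʳ 0# ⟩
          0#                                                         ∎
          where
            term≈0 : coeff f e * Ψ e ≈ 0#
            term≈0 = [ (λ Ψe≈0 → trans (*-congˡ Ψe≈0) (zeroʳ _)) , (λ fe≈0 → trans (*-congʳ fe≈0) (zeroˡ _)) ]′ (vanish e)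
            shorter : List.length (removeMonomial e f) ≤ k
            shorter = ℕₚ.≤-trans (ℕₚ.≤-pred (Listₚ.filter-notAll (exponent≢? e) f (here (λ e≢e → e≢e ≡.refl)))) len
            vanish′ = vanishing-removeMonomial Ψ e f (λ e′ _ → vanish e′)

    linearExtension-concentrated : ∀ (Ψ : Vec ℕ n → Carrier) (f : Poly n) e →
      (∀ e′ → e′ ≢ e → Ψ e′ ≈ 0# ⊎ coeff f e′ ≈ 0#) → linearExtension Ψ f ≈ coeff f e * Ψ e
    linearExtension-concentrated Ψ f e vanish = begin
      linearExtension Ψ f
        ≈⟨ linearExtension-split Ψ e f ⟩
      coeff f e * Ψ e + linearExtension Ψ (removeMonomial e f)
        ≈⟨ +-congˡ (linearExtension≈0 Ψ (removeMonomial e f) (vanishing-removeMonomial Ψ e f vanish)) ⟩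
      coeff f e * Ψ e + 0#
        ≈⟨ +-identityʳ _ ⟩
      coeff f e * Ψ e
        ∎

  module Grid (n : ℕ) (A : Fin n → FiniteSubgroup) where
    module G (i : Fin n) = FiniteSubgroupProperties (A i)

    m : Fin n → ℕ
    m i = size (A i)

    E : Vec ℕ n
    E = tabulate (λ i → m i ∸ 1)

    N : Carrier
    N = natF (prodℕ n m)

    gridSum : Poly n → Carrier
    gridSum f = Σ' (map (λ a → prodF n a * eval f a) (grid n (λ i → elems (A i))))

    moment : Vec ℕ n → Carrier
    moment e = ∏ (λ i → G.powerSum i (suc (lookup e i)))

    gridSum≈linearExtension : ∀ f → gridSum f ≈ linearExtension moment f
    gridSum≈linearExtension f = begin
      gridSum f
        ≈⟨ Σ'-cong (λ a → x*eval≈Σ'x^[1+e] a) Γ ⟩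
      Σ' (map (λ a → Σ' (map (term a) f)) Γ)
        ≈⟨ Σ'-comm term Γ f ⟩
      Σ' (map (λ t → Σ' (map (λ a → term a t) Γ)) f)
        ≈⟨ Σ'-cong (λ (c , e) → Σ'-distribˡ c (λ a → ∏ (λ i → a i ^ suc (lookup e i))) Γ) f ⟩
      Σ' (map (λ (c , e) → c * Σ' (map (λ a → ∏ (λ i → a i ^ suc (lookup e i))) Γ)) f)
        ≈⟨ Σ'-cong (λ (c , e) → *-congˡ (Σ'-grid-∏ n (λ i → elems (A i)) (λ i y → y ^ suc (lookup e i)))) f ⟩
      Σ' (map (λ (c , e) → c * ∏ (λ i → Σ' (map (_^ suc (lookup e i)) (elems (A i))))) f)
        ≡⟨ ≡.cong Σ' (Listₚ.map-cong (λ (c , e) → ≡.cong (c *_) (Σ*.sum-cong-≗ (λ i → G.Σ'-elems i _))) f) ⟩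
      linearExtension moment f
        ∎
      where
        Γ = grid n (λ i → elems (A i))
        term : Vector Carrier n → Σ Carrier (λ _ → Vec ℕ n) → Carrier
        term a (c , e) = c * ∏ (λ i → a i ^ suc (lookup e i))
        x*eval≈Σ'x^[1+e] : ∀ a → prodF n a * eval f a ≈ Σ' (map (term a) f)
        x*eval≈Σ'x^[1+e] a = trans (sym (Σ'-distribˡ (prodF n a) _ f)) (Σ'-cong (λ (c , e) → begin
          prodF n a * (c * prodF n (λ i → pow (a i) (lookup e i)))  ≈⟨ x∙yz≈y∙xz _ c _ ⟩
          c * (prodF n a * prodF n (λ i → pow (a i) (lookup e i)))  ≈⟨ *-congˡ (prodF[x]*prodF[x^e]≈∏x^[1+e] n a (lookup e)) ⟩
          c * ∏ (λ i → a i ^ suc (lookup e i))                      ∎) f)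

    degreeBound : ℕ
    degreeBound = sumℕ n (λ i → m i ∸ 1) +ℕ minℕ n m ∸ 1

    moment≈0 : ∀ e → e ≢ E → sumℕ n (lookup e) ≤ degreeBound → moment e ≈ 0#
    moment≈0 e e≢E low with nondividing-index n m G.m≥1 e e≢E low
    ... | j , m∤ = ∏-≈0 _ j (G.powerSum≈0 j _ m∤)

    moment-E≈N : moment E ≈ N
    moment-E≈N = begin
      ∏ (λ i → G.powerSum i (suc (lookup E i)))  ≡⟨ Σ*.sum-cong-≗ (λ i → ≡.cong (G.powerSum i) (suc[lookup-E]≡m i)) ⟩
      ∏ (λ i → G.powerSum i (m i))               ≈⟨ Σ*.sum-cong-≋ G.powerSum-size ⟩
      ∏ (natF ∘ m)                               ≈⟨ natF-prodℕ n m ⟨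
      N                                          ∎
      where
        suc[lookup-E]≡m : ∀ i → suc (lookup E i) ≡ m i
        suc[lookup-E]≡m i = ≡.trans (≡.cong suc (Vecₚ.lookup∘tabulate _ i)) (ℕₚ.m+[n∸m]≡n (G.m≥1 i))

    N≉0 : ¬ N ≈ 0#
    N≉0 N≈0 = ∏-≉0 (natF ∘ m) G.natF-size≉0 (trans (sym (natF-prodℕ n m)) N≈0)

    moment⊎coeff≈0 : ∀ f → DegLe f degreeBound → ∀ e → e ≢ E → moment e ≈ 0# ⊎ coeff f e ≈ 0#
    moment⊎coeff≈0 f deg e e≢E with sumℕ n (lookup e) ℕₚ.≤? degreeBound
    ... | yes low = inj₁ (moment≈0 e e≢E low)
    ... | no high = inj₂ (deg e (ℕₚ.≰⇒> high))

corollary6p6 : ∀ {c ℓ : Level} (F : Field c ℓ) (n : ℕ) → 1 ≤ n →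
    let open Field F
        open FieldDefs F
    in (A : Fin n → FiniteSubgroup) (f : Poly n) →
       DegLe f (sumℕ n (λ i → size (A i) ∸ 1) +ℕ minℕ n (λ i → size (A i)) ∸ 1) →
       let N = natF (prodℕ n (λ i → size (A i)))
       in Σ (¬ (N ≈ 0#)) (λ N≉0 →
            coeff f (tabulate (λ i → size (A i) ∸ 1))
              ≈ (N ⁻¹[ N≉0 ]) * Σ' (map (λ a → prodF n a * eval f a) (grid n (λ i → elems (A i)))))
corollary6p6 F n _ A f deg = N≉0 , x*y≈z⇒y≈x⁻¹*z F N≉0 (begin
    N * coeff f E               ≈⟨ *-comm N _ ⟩
    coeff f E * N               ≈⟨ *-congˡ moment-E≈N ⟨
    coeff f E * moment E        ≈⟨ linearExtension-concentrated F moment f E (moment⊎coeff≈0 f deg) ⟨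
    linearExtension F moment f  ≈⟨ gridSum≈linearExtension f ⟨
    gridSum f                   ∎)
  where
    open Field F
    open FieldDefs F
    open Grid F n A
    open import Relation.Binary.Reasoning.Setoid setoid
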